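{- Let $m$ be odd and let $C$ be a Hamilton cycle of the grid graph $G(m,n)$. Then $C$ has at least $2n$ turns.
   Context: $G(m,n)$ is the graph on cells $\{1,\dots,m\}\times\{1,\dots,n\}$ with $(a,b),(c,d)$ adjacent iff $|a-c|+|b-d|=1$. A Hamilton cycle is a cycle through every cell. A turn of a cycle is a cell of the cycle whose two incident cycle edges are one horizontal (same second coordinate) and one vertical (same first coordinate). -}

module Defs where

open import Data.Nat using (ℕ; zero; suc; _+_; _*_; _≤_; _<_)
open import Data.Nat.Properties using ()
open import Data.Fin using (Fin; zero; suc; toℕ; inject₁; fromℕ; _≟_)
open import Data.Fin.Properties using ()
open import Data.Product using (Σ; _×_; _,_; proj₁; proj₂)
open import Data.Sum using (_⊎_)
open import Data.Bool using (Bool; true; false; _∨_; _∧_; not)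
open import Data.List using (List; length; filter; allFin)
open import Relation.Nullary using (Dec; yes; no; ¬_)
open import Relation.Nullary.Decidable using (⌊_⌋)
open import Relation.Binary.PropositionalEquality using (_≡_)
open import Function.Bundles using (_⤖_)

-- Cells of G(m,n): (a , b) with a ∈ {1..m}, b ∈ {1..n}, encoded 0-based by Fin.
Cell : ℕ → ℕ → Set
Cell m n = Fin m × Fin n

∣_-_∣ : ℕ → ℕ → ℕ
∣ zero - b ∣ = b
∣ suc a - zero ∣ = suc a
∣ suc a - suc b ∣ = ∣ a - b ∣

Adjacent : ∀ {m n} → Cell m n → Cell m n → Set
Adjacent (a , b) (c , d) = ∣ toℕ a - toℕ c ∣ + ∣ toℕ b - toℕ d ∣ ≡ 1

-- cyclic successor and predecessor on indices Fin (suc k)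
next : ∀ {k} → Fin (suc k) → Fin (suc k)
next {zero} zero = zero
next {suc k} zero = suc zero
next {suc k} (suc i) with next {k} i
... | zero = zero
... | suc j = suc (suc j)

prev : ∀ {k} → Fin (suc k) → Fin (suc k)
prev {k} zero = fromℕ k
prev (suc i) = inject₁ i

-- A Hamilton cycle of G(m,n): a cyclic enumeration c₀,…,c_{N-1} of all cells
-- (N = m·n, bijectively), consecutive cells (cyclically) adjacent, N ≥ 3.
record HamiltonCycle (m n : ℕ) : Set where
  field
    len      : ℕ
    len≡     : suc len ≡ m * n
    len≥     : 2 ≤ len
    vertex   : Fin (suc len) ⤖ Cell m n
  c : Fin (suc len) → Cell m n
  c = Function.Bundles.Bijection.to vertex
  field
    adjacent : ∀ i → Adjacent (c i) (c (next i))

horizontal? : ∀ {m n} → Cell m n → Cell m n → Bool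
horizontal? (a , b) (c , d) = ⌊ b ≟ d ⌋

vertical? : ∀ {m n} → Cell m n → Cell m n → Bool
vertical? (a , b) (c , d) = ⌊ a ≟ c ⌋

isTurn : ∀ {m n} (C : HamiltonCycle m n) → Fin (suc (HamiltonCycle.len C)) → Bool
isTurn C i =
  (horizontal? (c (prev i)) (c i) ∧ vertical? (c i) (c (next i)))
  ∨ (vertical? (c (prev i)) (c i) ∧ horizontal? (c i) (c (next i)))
  where open HamiltonCycle C

turns : ∀ {m n} → HamiltonCycle m n → ℕ
turns C = length (filter (λ i → isTurn C i ≡? true) (allFin _))
  where
  _≡?_ : (x y : Bool) → Dec (x ≡ y)
  _≡?_ = Data.Bool._≟_

{-# OPTIONS --safe #-}

-- Count turns row by row. A cell of row b is a turn exactly when one of its two cycle neighbours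
-- lies outside row b, so the number of turns in row b has the parity of the number of cycle edges
-- leaving row b, which is even. If row b had no turn, no cell of it could be passed horizontally
-- (such a run would go on leftwards forever), so the cycle would cross each of the m cells of row b
-- vertically; these m crossings are exactly the cycle edges between rows ≤ b and rows > b, an even
-- number, contradicting m odd. Hence each of the n rows contains at least two turns.

module Submission where

open import Defs
open import Data.Nat using (ℕ; zero; suc; _+_; _*_; _≤_; _<_; _%_; _/_; z≤n; s≤s; _≤?_)
open import Data.Nat.Properties as ℕ using ()
open import Data.Nat.DivMod using (m≡m%n+[m/n]*n)
open import Data.Parity.Base as ℙ using (Parity; 0ℙ; 1ℙ)
open import Data.Parity.Properties as ℙ using (+-homo-+; *-homo-*; p+p≡0ℙ)
open import Data.Nat.Base using (parity)
open import Data.Bool using (Bool; true; false; not; _∧_; _∨_)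
import Data.Bool.Properties as Boolₚ
open import Data.Fin using (Fin; zero; suc; toℕ; inject₁; fromℕ; _≟_; _↑ˡ_; _↑ʳ_; combine; remQuot)
open import Data.Fin.Properties as Finₚ using (toℕ-injective; toℕ-inject₁; remQuot-combine; *↔×)
open import Data.Fin.Permutation using (Permutation; Permutation′; permutation; _⟨$⟩ʳ_; _⟨$⟩ˡ_; inverseʳ; flip)
open import Data.Fin.Relation.Unary.Top using (view; ‵fromℕ; ‵inject₁)
open import Data.List using (length; filter; tabulate)
open import Data.Product using (_×_; _,_; proj₁; proj₂)
open import Data.Product.Properties using (×-≡,≡→≡)
open import Data.Sum as ⊎ using (_⊎_; inj₁; inj₂)
open import Data.Empty using (⊥-elim)
open import Function using (_∘_; id; _⤖_; Equivalence; mk⇔)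
open import Function.Properties.Bijection using (⤖⇒↔)
open import Function.Properties.Inverse using (↔-sym; ↔-trans)
open import Relation.Nullary using (Dec; yes; no; ¬_)
open import Relation.Nullary.Decidable using (⌊_⌋; toWitness; isYes≗does; ⌊⌋-map′; dec-true; dec-false; does-⇔)
open import Relation.Binary.PropositionalEquality
import Algebra.Properties.CommutativeMonoid.Sum as Sum
open Sum ℕ.+-0-commutativeMonoid using (sum; sum-syntax; sum-replicate-zero; ∑-comm; ∑-permute; sum-cong-≗)
module ℙΣ = Sum ℙ.+-0-commutativeMonoid

⟦_⟧ : Bool → ℕ
⟦ true ⟧ = 1
⟦ false ⟧ = 0

⟦⟧≡0⇒≡false : ∀ {t} → ⟦ t ⟧ ≡ 0 → t ≡ false
⟦⟧≡0⇒≡false {false} _ = refl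

⌊⌋≡true : ∀ {a} {A : Set a} (a? : Dec A) → A → ⌊ a? ⌋ ≡ true
⌊⌋≡true a? a = trans (isYes≗does a?) (dec-true a? a)

⌊⌋≡false : ∀ {a} {A : Set a} (a? : Dec A) → ¬ A → ⌊ a? ⌋ ≡ false
⌊⌋≡false a? ¬a = trans (isYes≗does a?) (dec-false a? ¬a)

⌊⌋≡false⇒ : ∀ {a} {A : Set a} (a? : Dec A) → ⌊ a? ⌋ ≡ false → ¬ A
⌊⌋≡false⇒ a? e a with () ← trans (sym e) (⌊⌋≡true a? a)

⌊⌋≡true⇒ : ∀ {a} {A : Set a} (a? : Dec A) → ⌊ a? ⌋ ≡ true → A
⌊⌋≡true⇒ a? e = toWitness (Equivalence.from Boolₚ.T-≡ e)

⌊≟⌋-sym : ∀ {k} (x y : Fin k) → ⌊ x ≟ y ⌋ ≡ ⌊ y ≟ x ⌋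
⌊≟⌋-sym x y = begin
  ⌊ x ≟ y ⌋    ≡⟨ isYes≗does (x ≟ y) ⟩
  Dec.does (x ≟ y) ≡⟨ does-⇔ (mk⇔ sym sym) (x ≟ y) (y ≟ x) ⟩
  Dec.does (y ≟ x) ≡⟨ isYes≗does (y ≟ x) ⟨
  ⌊ y ≟ x ⌋    ∎
  where open ≡-Reasoning

∑-↑ : ∀ k {l} (f : Fin (k + l) → ℕ) → sum f ≡ sum (f ∘ (_↑ˡ l)) + sum (f ∘ (k ↑ʳ_))
∑-↑ zero f = refl
∑-↑ (suc k) f = trans (cong (f zero +_) (∑-↑ k (f ∘ suc))) (sym (ℕ.+-assoc (f zero) _ _))

∑-combine : ∀ m n (g : Fin (m * n) → ℕ) → sum g ≡ ∑[ a < m ] ∑[ b < n ] g (combine a b)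
∑-combine zero n g = refl
∑-combine (suc m) n g = trans (∑-↑ n g) (cong (sum (g ∘ (_↑ˡ m * n)) +_) (∑-combine m n (g ∘ (n ↑ʳ_))))

∑-⤖× : ∀ {k m n} (e : Fin k ⤖ (Fin m × Fin n)) (h : Fin m × Fin n → ℕ) →
        ∑[ i < k ] h (Function.Bijection.to e i) ≡ ∑[ a < m ] ∑[ b < n ] h (a , b)
∑-⤖× {k} {m} {n} e h = begin
  ∑[ i < k ] h (to i)
    ≡⟨ sum-cong-≗ (λ i → cong h (remQuot-combine (proj₁ (to i)) (proj₂ (to i)))) ⟨
  ∑[ i < k ] h (remQuot n (π ⟨$⟩ʳ i))
    ≡⟨ ∑-permute (h ∘ remQuot n) π ⟨
  ∑[ x < m * n ] h (remQuot n x)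
    ≡⟨ ∑-combine m n (h ∘ remQuot n) ⟩
  ∑[ a < m ] ∑[ b < n ] h (remQuot n (combine a b))
    ≡⟨ sum-cong-≗ (λ a → sum-cong-≗ (λ b → cong h (remQuot-combine a b))) ⟩
  ∑[ a < m ] ∑[ b < n ] h (a , b)
    ∎
  where
  open ≡-Reasoning
  open Function.Bijection e using (to)
  π : Permutation k (m * n)
  π = ↔-trans (⤖⇒↔ e) (↔-sym *↔×)

∑-δ : ∀ {k} (j : Fin k) → ∑[ i < k ] ⟦ ⌊ i ≟ j ⌋ ⟧ ≡ 1
∑-δ {suc k} zero = cong suc (sum-replicate-zero k)
∑-δ {suc k} (suc j) = trans (sum-cong-≗ (λ i → cong ⟦_⟧ (⌊⌋-map′ (cong suc) Finₚ.suc-injective (i ≟ j)))) (∑-δ j)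

sum≡0⇒≡0 : ∀ {k} (f : Fin k → ℕ) → sum f ≡ 0 → ∀ i → f i ≡ 0
sum≡0⇒≡0 f e zero = ℕ.m+n≡0⇒m≡0 (f zero) e
sum≡0⇒≡0 f e (suc i) = sum≡0⇒≡0 (f ∘ suc) (ℕ.m+n≡0⇒n≡0 (f zero) e) i

∑-lowerBound : ∀ {k d} (f : Fin k → ℕ) → (∀ i → d ≤ f i) → k * d ≤ sum f
∑-lowerBound {zero} f d≤f = z≤n
∑-lowerBound {suc k} f d≤f = ℕ.+-mono-≤ (d≤f zero) (∑-lowerBound (f ∘ suc) (d≤f ∘ suc))

length-filter-tabulate : ∀ {a} {A : Set a} {k} (f : Fin k → A) (q : A → Bool) →
  length (filter (λ x → q x Boolₚ.≟ true) (tabulate f)) ≡ ∑[ i < k ] ⟦ q (f i) ⟧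
length-filter-tabulate {k = zero} f q = refl
length-filter-tabulate {k = suc k} f q with q (f zero)
... | true = cong suc (length-filter-tabulate (f ∘ suc) q)
... | false = length-filter-tabulate (f ∘ suc) q

parity-sum : ∀ {k} (f : Fin k → ℕ) → parity (sum f) ≡ ℙΣ.sum (parity ∘ f)
parity-sum {zero} f = refl
parity-sum {suc k} f = trans (+-homo-+ (f zero) (sum (f ∘ suc))) (cong (parity (f zero) ℙ.+_) (parity-sum (f ∘ suc)))

even∧≢0⇒≥2 : ∀ {x} → parity x ≡ 0ℙ → x ≢ 0 → 2 ≤ x
even∧≢0⇒≥2 {zero} _ x≢0 = ⊥-elim (x≢0 refl)
even∧≢0⇒≥2 {suc (suc x)} _ _ = s≤s (s≤s z≤n)

%2≡1⇒parity≡1ℙ : ∀ m → m % 2 ≡ 1 → parity m ≡ 1ℙ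
%2≡1⇒parity≡1ℙ m odd = begin
  parity m                           ≡⟨ cong parity (m≡m%n+[m/n]*n m 2) ⟩
  parity (m % 2 + m / 2 * 2)         ≡⟨ +-homo-+ (m % 2) (m / 2 * 2) ⟩
  parity (m % 2) ℙ.+ parity (m / 2 * 2) ≡⟨ cong₂ ℙ._+_ (cong parity odd) (*-homo-* (m / 2) 2) ⟩
  1ℙ ℙ.+ (parity (m / 2) ℙ.* 0ℙ)     ≡⟨ cong (1ℙ ℙ.+_) (ℙ.*-zeroʳ (parity (m / 2))) ⟩
  1ℙ                                 ∎
  where open ≡-Reasoning

cutDegree : ∀ {k} → Permutation′ k → (Fin k → Bool) → Fin k → ℕ
cutDegree π S i = ⟦ S i ∧ not (S (π ⟨$⟩ˡ i)) ⟧ + ⟦ S i ∧ not (S (π ⟨$⟩ʳ i)) ⟧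

-- Modulo 2, ⟦ s ∧ not p ⟧ ≡ s + s p, so the sum is twice ∑ j, ⟦ S j ∧ S (π j) ⟧.
parity-∑-cutDegree : ∀ {k} (π : Permutation′ k) (S : Fin k → Bool) → parity (sum (cutDegree π S)) ≡ 0ℙ
parity-∑-cutDegree {k} π S = begin
  parity (sum (cutDegree π S))                      ≡⟨ parity-sum (cutDegree π S) ⟩
  ℙΣ.sum (parity ∘ cutDegree π S)                   ≡⟨ ℙΣ.sum-cong-≗ termwise ⟩
  ℙΣ.sum (λ i → inside (π ⟨$⟩ˡ i) ℙ.+ inside i)     ≡⟨ ℙΣ.∑-distrib-+ (inside ∘ (π ⟨$⟩ˡ_)) inside ⟩
  ℙΣ.sum (inside ∘ (π ⟨$⟩ˡ_)) ℙ.+ ℙΣ.sum inside     ≡⟨ cong (ℙ._+ ℙΣ.sum inside) (ℙΣ.∑-permute inside (flip π)) ⟨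
  ℙΣ.sum inside ℙ.+ ℙΣ.sum inside                   ≡⟨ p+p≡0ℙ (ℙΣ.sum inside) ⟩
  0ℙ                                                ∎
  where
  open ≡-Reasoning
  inside : Fin k → Parity
  inside j = parity ⟦ S j ∧ S (π ⟨$⟩ʳ j) ⟧
  cut-mod2 : ∀ p s q → parity (⟦ s ∧ not p ⟧ + ⟦ s ∧ not q ⟧) ≡ parity ⟦ p ∧ s ⟧ ℙ.+ parity ⟦ s ∧ q ⟧
  cut-mod2 false false q = refl
  cut-mod2 false true false = refl
  cut-mod2 false true true = refl
  cut-mod2 true false q = refl
  cut-mod2 true true false = refl
  cut-mod2 true true true = refl
  termwise : ∀ i → parity (cutDegree π S i) ≡ inside (π ⟨$⟩ˡ i) ℙ.+ inside i
  termwise i rewrite inverseʳ π {i} = cut-mod2 (S (π ⟨$⟩ˡ i)) (S i) (S (π ⟨$⟩ʳ i))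

next-inject₁ : ∀ {k} (i : Fin k) → next (inject₁ i) ≡ suc i
next-inject₁ {suc k} zero = refl
next-inject₁ {suc k} (suc i) rewrite next-inject₁ i = refl

next-fromℕ : ∀ k → next (fromℕ k) ≡ zero
next-fromℕ zero = refl
next-fromℕ (suc k) rewrite next-fromℕ k = refl

next-prev : ∀ {k} (i : Fin (suc k)) → next (prev i) ≡ i
next-prev {k} zero = next-fromℕ k
next-prev (suc i) = next-inject₁ i

prev-next : ∀ {k} (i : Fin (suc k)) → prev (next i) ≡ i
prev-next {k} i with view i
... | ‵fromℕ rewrite next-fromℕ k = refl
... | ‵inject₁ j rewrite next-inject₁ j = refl

rotation : ∀ k → Permutation′ (suc k)
rotation k = permutation next prev next-prev prev-next

prev≢next : ∀ {k} → 2 ≤ k → (i : Fin (suc k)) → prev i ≢ next i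
prev≢next {k} 2≤k i with view i
... | ‵fromℕ = λ e → prev-fromℕ≢zero 2≤k (trans e (next-fromℕ k))
  where
  prev-fromℕ≢zero : ∀ {k} → 2 ≤ k → prev (fromℕ k) ≢ zero
  prev-fromℕ≢zero (s≤s (s≤s _)) ()
... | ‵inject₁ j = λ e → prev-inject₁≢suc 2≤k j (trans e (next-inject₁ j))
  where
  prev-inject₁≢suc : ∀ {k} → 2 ≤ k → (j : Fin k) → prev (inject₁ j) ≢ suc j
  prev-inject₁≢suc (s≤s (s≤s _)) zero ()
  prev-inject₁≢suc _ (suc j) e = ℕ.m≢1+n+m (toℕ j) {1}
    (trans (sym (trans (toℕ-inject₁ (inject₁ j)) (toℕ-inject₁ j))) (cong toℕ e))

Consecutive : ℕ → ℕ → Set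
Consecutive a b = b ≡ suc a ⊎ a ≡ suc b

Consecutive-sym : ∀ {a b} → Consecutive a b → Consecutive b a
Consecutive-sym (inj₁ e) = inj₂ e
Consecutive-sym (inj₂ e) = inj₁ e

Consecutive⇒≢ : ∀ {a b} → Consecutive a b → a ≢ b
Consecutive⇒≢ (inj₁ e) refl = ℕ.1+n≢n (sym e)
Consecutive⇒≢ (inj₂ e) refl = ℕ.1+n≢n (sym e)

Consecutive⇒≤suc : ∀ {a b} → Consecutive a b → b ≤ suc a
Consecutive⇒≤suc (inj₁ e) = ℕ.≤-reflexive e
Consecutive⇒≤suc (inj₂ refl) = ℕ.m≤n⇒m≤1+n (ℕ.n≤1+n _)

Consecutive-opposite : ∀ {x y z} → Consecutive y x → Consecutive x z → y ≢ z →
                       (suc y ≡ x × z ≡ suc x) ⊎ (y ≡ suc x × suc z ≡ x)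
Consecutive-opposite (inj₁ x≡1+y) (inj₁ z≡1+x) _ = inj₁ (sym x≡1+y , z≡1+x)
Consecutive-opposite (inj₁ refl) (inj₂ e) y≢z = ⊥-elim (y≢z (ℕ.suc-injective e))
Consecutive-opposite (inj₂ refl) (inj₁ refl) y≢z = ⊥-elim (y≢z refl)
Consecutive-opposite (inj₂ y≡1+x) (inj₂ x≡1+z) _ = inj₂ (y≡1+x , sym x≡1+z)

∣-∣≡0⇒≡ : ∀ a b → ∣ a - b ∣ ≡ 0 → a ≡ b
∣-∣≡0⇒≡ zero zero _ = refl
∣-∣≡0⇒≡ (suc a) (suc b) e = cong suc (∣-∣≡0⇒≡ a b e)

∣-∣≡1⇒Consecutive : ∀ a b → ∣ a - b ∣ ≡ 1 → Consecutive a b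
∣-∣≡1⇒Consecutive zero (suc zero) _ = inj₁ refl
∣-∣≡1⇒Consecutive (suc zero) zero _ = inj₂ refl
∣-∣≡1⇒Consecutive (suc a) (suc b) e with ∣-∣≡1⇒Consecutive a b e
... | inj₁ b≡1+a = inj₁ (cong suc b≡1+a)
... | inj₂ a≡1+b = inj₂ (cong suc a≡1+b)

module _ {m n : ℕ} where

  VerticalStep HorizontalStep : Cell m n → Cell m n → Set
  VerticalStep (a , b) (c , d) = a ≡ c × Consecutive (toℕ b) (toℕ d)
  HorizontalStep (a , b) (c , d) = b ≡ d × Consecutive (toℕ a) (toℕ c)

  adjacent⇒step : ∀ x y → Adjacent x y → VerticalStep x y ⊎ HorizontalStep x y
  adjacent⇒step (a , b) (c , d) e with ∣ toℕ a - toℕ c ∣ in ea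
  ... | zero = inj₁ (toℕ-injective (∣-∣≡0⇒≡ _ _ ea) , ∣-∣≡1⇒Consecutive _ _ e)
  ... | suc zero = inj₂ (toℕ-injective (∣-∣≡0⇒≡ _ _ (ℕ.suc-injective e)) , ∣-∣≡1⇒Consecutive _ _ ea)

  vertical?≡not-horizontal? : ∀ x y → Adjacent x y → vertical? x y ≡ not (horizontal? x y)
  vertical?≡not-horizontal? x@(a , b) y@(c , d) adj with adjacent⇒step x y adj
  ... | inj₁ (a≡c , b∼d) = trans (⌊⌋≡true (a ≟ c) a≡c)
                                  (cong not (sym (⌊⌋≡false (b ≟ d) (Consecutive⇒≢ b∼d ∘ cong toℕ))))
  ... | inj₂ (b≡d , a∼c) = trans (⌊⌋≡false (a ≟ c) (Consecutive⇒≢ a∼c ∘ cong toℕ))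
                                  (cong not (sym (⌊⌋≡true (b ≟ d) b≡d)))

  sameRow⇒HorizontalStep : ∀ x y → Adjacent x y → proj₂ x ≡ proj₂ y → HorizontalStep x y
  sameRow⇒HorizontalStep x y adj b≡d with adjacent⇒step x y adj
  ... | inj₁ (_ , b∼d) = ⊥-elim (Consecutive⇒≢ b∼d (cong toℕ b≡d))
  ... | inj₂ step = step

  differentRow⇒VerticalStep : ∀ x y → Adjacent x y → proj₂ x ≢ proj₂ y → VerticalStep x y
  differentRow⇒VerticalStep x y adj b≢d with adjacent⇒step x y adj
  ... | inj₁ step = step
  ... | inj₂ (b≡d , _) = ⊥-elim (b≢d b≡d)

  adjacent⇒rows≤suc : ∀ x y → Adjacent x y →
                      toℕ (proj₂ y) ≤ suc (toℕ (proj₂ x)) × toℕ (proj₂ x) ≤ suc (toℕ (proj₂ y))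
  adjacent⇒rows≤suc x y adj with adjacent⇒step x y adj
  ... | inj₁ (_ , b∼d) = Consecutive⇒≤suc b∼d , Consecutive⇒≤suc (Consecutive-sym b∼d)
  ... | inj₂ (refl , _) = ℕ.n≤1+n _ , ℕ.n≤1+n _

module HamiltonCycleRows {m n : ℕ} (C : HamiltonCycle m n) where
  open HamiltonCycle C

  row : Fin (suc len) → Fin n
  row i = proj₂ (c i)

  col : Fin (suc len) → Fin m
  col i = proj₁ (c i)

  adjacent-prev : ∀ i → Adjacent (c (prev i)) (c i)
  adjacent-prev i = subst (Adjacent (c (prev i)) ∘ c) (next-prev i) (adjacent (prev i))

  c-prev≢c-next : ∀ i → c (prev i) ≢ c (next i)
  c-prev≢c-next i = prev≢next len≥ i ∘ Function.Bijection.injective vertex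

  isTurn≡ : ∀ i → let h₁ = horizontal? (c (prev i)) (c i); h₂ = horizontal? (c i) (c (next i)) in
            isTurn C i ≡ (h₁ ∧ not h₂) ∨ (not h₁ ∧ h₂)
  isTurn≡ i = cong₂ (λ v₂ v₁ → (horizontal? (c (prev i)) (c i) ∧ v₂) ∨ (v₁ ∧ horizontal? (c i) (c (next i))))
    (vertical?≡not-horizontal? (c i) (c (next i)) (adjacent i))
    (vertical?≡not-horizontal? (c (prev i)) (c i) (adjacent-prev i))

  inRow : Fin n → Fin (suc len) → Bool
  inRow b i = ⌊ row i ≟ b ⌋

  turnsInRow : Fin n → ℕ
  turnsInRow b = ∑[ i < suc len ] ⟦ inRow b i ∧ isTurn C i ⟧

  turns≡∑turnsInRow : turns C ≡ ∑[ b < n ] turnsInRow b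
  turns≡∑turnsInRow = begin
    turns C                                             ≡⟨ length-filter-tabulate id (isTurn C) ⟩
    ∑[ i < suc len ] ⟦ isTurn C i ⟧                     ≡⟨ sum-cong-≗ (λ i → ∑-inRow i (isTurn C i)) ⟨
    ∑[ i < suc len ] ∑[ b < n ] ⟦ inRow b i ∧ isTurn C i ⟧ ≡⟨ ∑-comm (λ i b → ⟦ inRow b i ∧ isTurn C i ⟧) ⟩
    ∑[ b < n ] turnsInRow b                             ∎
    where
    open ≡-Reasoning
    ∑-inRow : ∀ i t → ∑[ b < n ] ⟦ inRow b i ∧ t ⟧ ≡ ⟦ t ⟧
    ∑-inRow i true = trans (sum-cong-≗ (λ b → cong ⟦_⟧ (trans (Boolₚ.∧-identityʳ _) (⌊≟⌋-sym (row i) b)))) (∑-δ (row i))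
    ∑-inRow i false = trans (sum-cong-≗ (λ b → cong ⟦_⟧ (Boolₚ.∧-zeroʳ (inRow b i)))) (sum-replicate-zero n)

  sameRow : ∀ {b i j} → inRow b i ≡ true → inRow b j ≡ true → row i ≡ row j
  sameRow gi gj = trans (⌊⌋≡true⇒ _ gi) (sym (⌊⌋≡true⇒ _ gj))

  isTurn-inRow : ∀ b i → inRow b i ≡ true → let p = inRow b (prev i); q = inRow b (next i) in
                 isTurn C i ≡ (p ∧ not q) ∨ (not p ∧ q)
  isTurn-inRow b i gi = trans (isTurn≡ i) (cong₂ (λ p q → (p ∧ not q) ∨ (not p ∧ q)) h₁≡p h₂≡q)
    where
    h₁≡p : horizontal? (c (prev i)) (c i) ≡ inRow b (prev i)
    h₁≡p = cong (λ r → ⌊ row (prev i) ≟ r ⌋) (⌊⌋≡true⇒ _ gi)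
    h₂≡q : horizontal? (c i) (c (next i)) ≡ inRow b (next i)
    h₂≡q = trans (cong (λ r → ⌊ r ≟ row (next i) ⌋) (⌊⌋≡true⇒ _ gi)) (⌊≟⌋-sym b (row (next i)))

  parity-turnsInRow : ∀ b → parity (turnsInRow b) ≡ 0ℙ
  parity-turnsInRow b = begin
    parity (turnsInRow b)                                ≡⟨ parity-sum (λ i → ⟦ inRow b i ∧ isTurn C i ⟧) ⟩
    ℙΣ.sum (λ i → parity ⟦ inRow b i ∧ isTurn C i ⟧)      ≡⟨ ℙΣ.sum-cong-≗ termwise ⟩
    ℙΣ.sum (parity ∘ cutDegree (rotation len) (inRow b)) ≡⟨ parity-sum (cutDegree (rotation len) (inRow b)) ⟨
    parity (sum (cutDegree (rotation len) (inRow b)))    ≡⟨ parity-∑-cutDegree (rotation len) (inRow b) ⟩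
    0ℙ                                                   ∎
    where
    open ≡-Reasoning
    turn-mod2 : ∀ s p q t → (s ≡ true → t ≡ (p ∧ not q) ∨ (not p ∧ q)) →
                parity ⟦ s ∧ t ⟧ ≡ parity (⟦ s ∧ not p ⟧ + ⟦ s ∧ not q ⟧)
    turn-mod2 false p q t _ = refl
    turn-mod2 true p q t turn with turn refl
    turn-mod2 true false false _ _ | refl = refl
    turn-mod2 true false true _ _ | refl = refl
    turn-mod2 true true false _ _ | refl = refl
    turn-mod2 true true true _ _ | refl = refl
    termwise : ∀ i → parity ⟦ inRow b i ∧ isTurn C i ⟧ ≡ parity (cutDegree (rotation len) (inRow b) i)
    termwise i = turn-mod2 (inRow b i) (inRow b (prev i)) (inRow b (next i)) (isTurn C i) (isTurn-inRow b i)

  rowSize : ∀ b → ∑[ i < suc len ] ⟦ inRow b i ⟧ ≡ m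
  rowSize b = begin
    ∑[ i < suc len ] ⟦ inRow b i ⟧          ≡⟨ ∑-⤖× {n = n} vertex (λ x → ⟦ ⌊ proj₂ x ≟ b ⌋ ⟧) ⟩
    ∑[ a < m ] ∑[ r < n ] ⟦ ⌊ r ≟ b ⌋ ⟧      ≡⟨ sum-cong-≗ {m} (λ _ → ∑-δ b) ⟩
    ∑[ a < m ] 1                            ≡⟨ ∑-1 m ⟩
    m                                       ∎
    where
    open ≡-Reasoning
    ∑-1 : ∀ k → ∑[ i < k ] 1 ≡ k
    ∑-1 zero = refl
    ∑-1 (suc k) = cong suc (∑-1 k)

  module TurnlessRow (b : Fin n) (turnless : ∀ i → inRow b i ≡ true → isTurn C i ≡ false) where

    straight : ∀ i → inRow b i ≡ true → inRow b (prev i) ≡ inRow b (next i)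
    straight i gi = exclusive (inRow b (prev i)) (inRow b (next i)) (trans (sym (isTurn-inRow b i gi)) (turnless i gi))
      where
      exclusive : ∀ p q → (p ∧ not q) ∨ (not p ∧ q) ≡ false → p ≡ q
      exclusive false false _ = refl
      exclusive true true _ = refl

    HorizontalRun : Fin (suc len) → Set
    HorizontalRun i = inRow b i ≡ true × inRow b (prev i) ≡ true × inRow b (next i) ≡ true

    run-prev : ∀ {i} → HorizontalRun i → HorizontalRun (prev i)
    run-prev {i} (gi , gp , _) = gp , trans (straight (prev i) gp) gpn , gpn
      where gpn = trans (cong (inRow b) (next-prev i)) gi

    run-next : ∀ {i} → HorizontalRun i → HorizontalRun (next i)
    run-next {i} (gi , _ , gq) = gq , gqp , trans (sym (straight (next i) gq)) gqp
      where gqp = trans (cong (inRow b) (prev-next i)) gi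

    run-stepsLeft : ∀ {i} → HorizontalRun i →
                    suc (toℕ (col (prev i))) ≡ toℕ (col i) ⊎ suc (toℕ (col (next i))) ≡ toℕ (col i)
    run-stepsLeft {i} (gi , gp , gq) = ⊎.map proj₁ proj₂ (Consecutive-opposite colsPrev colsNext cols≢)
      where
      colsPrev = proj₂ (sameRow⇒HorizontalStep (c (prev i)) (c i) (adjacent-prev i) (sameRow gp gi))
      colsNext = proj₂ (sameRow⇒HorizontalStep (c i) (c (next i)) (adjacent i) (sameRow gi gq))
      cols≢ : toℕ (col (prev i)) ≢ toℕ (col (next i))
      cols≢ e = c-prev≢c-next i (×-≡,≡→≡ (toℕ-injective e , sameRow gp gq))

    no-horizontalRun : ∀ a i → toℕ (col i) ≡ a → ¬ HorizontalRun i
    no-horizontalRun a i col≡a run with run-stepsLeft run | a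
    ... | inj₁ left | zero = ℕ.1+n≢0 (trans left col≡a)
    ... | inj₁ left | suc a′ = no-horizontalRun a′ (prev i) (ℕ.suc-injective (trans left col≡a)) (run-prev run)
    ... | inj₂ left | zero = ℕ.1+n≢0 (trans left col≡a)
    ... | inj₂ left | suc a′ = no-horizontalRun a′ (next i) (ℕ.suc-injective (trans left col≡a)) (run-next run)

    vertical-through : ∀ i → inRow b i ≡ true → inRow b (prev i) ≡ false × inRow b (next i) ≡ false
    vertical-through i gi with inRow b (prev i) in gp | inRow b (next i) in gq | straight i gi
    ... | false | false | _ = refl , refl
    ... | true | true | _ = ⊥-elim (no-horizontalRun _ i refl (gi , gp , gq))

    below : Fin (suc len) → Bool
    below i = ⌊ toℕ (row i) ≤? toℕ b ⌋

    cutDegree-below≡ : ∀ i {s p q} → below i ≡ s → below (prev i) ≡ p → below (next i) ≡ q →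
                       cutDegree (rotation len) below i ≡ ⟦ s ∧ not p ⟧ + ⟦ s ∧ not q ⟧
    cutDegree-below≡ i refl refl refl = refl

    below-true : ∀ {i} → toℕ (row i) ≤ toℕ b → below i ≡ true
    below-true {i} = ⌊⌋≡true (toℕ (row i) ≤? toℕ b)

    below-false : ∀ {i} → toℕ b < toℕ (row i) → below i ≡ false
    below-false {i} b<r = ⌊⌋≡false (toℕ (row i) ≤? toℕ b) (ℕ.<⇒≱ b<r)

    cutDegree-onRow : ∀ i → row i ≡ b → cutDegree (rotation len) below i ≡ 1
    cutDegree-onRow i ri≡b = crossing (Consecutive-opposite (proj₂ stepPrev) (proj₂ stepNext) rows≢)
      where
      leaves = vertical-through i (⌊⌋≡true (row i ≟ b) ri≡b)
      stepPrev : VerticalStep (c (prev i)) (c i)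
      stepPrev = differentRow⇒VerticalStep _ _ (adjacent-prev i) λ e → ⌊⌋≡false⇒ _ (proj₁ leaves) (trans e ri≡b)
      stepNext : VerticalStep (c i) (c (next i))
      stepNext = differentRow⇒VerticalStep _ _ (adjacent i) λ e → ⌊⌋≡false⇒ _ (proj₂ leaves) (trans (sym e) ri≡b)
      rows≢ : toℕ (row (prev i)) ≢ toℕ (row (next i))
      rows≢ e = c-prev≢c-next i (×-≡,≡→≡ (trans (proj₁ stepPrev) (proj₁ stepNext) , toℕ-injective e))
      rp = toℕ (row (prev i))
      rq = toℕ (row (next i))
      ri≡b′ : toℕ (row i) ≡ toℕ b
      ri≡b′ = cong toℕ ri≡b
      crossing : (suc rp ≡ toℕ (row i) × rq ≡ suc (toℕ (row i))) ⊎ (rp ≡ suc (toℕ (row i)) × suc rq ≡ toℕ (row i)) →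
                 cutDegree (rotation len) below i ≡ 1
      crossing (inj₁ (1+rp≡ri , rq≡1+ri)) =
        cutDegree-below≡ i (below-true (ℕ.≤-reflexive ri≡b′))
                           (below-true (ℕ.<⇒≤ (ℕ.≤-reflexive (trans 1+rp≡ri ri≡b′))))
                           (below-false (ℕ.≤-reflexive (sym (trans rq≡1+ri (cong suc ri≡b′)))))
      crossing (inj₂ (rp≡1+ri , 1+rq≡ri)) =
        cutDegree-below≡ i (below-true (ℕ.≤-reflexive ri≡b′))
                           (below-false (ℕ.≤-reflexive (sym (trans rp≡1+ri (cong suc ri≡b′)))))
                           (below-true (ℕ.<⇒≤ (ℕ.≤-reflexive (trans 1+rq≡ri ri≡b′))))

    cutDegree-offRow : ∀ i → row i ≢ b → cutDegree (rotation len) below i ≡ 0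
    cutDegree-offRow i ri≢b with ℕ.≤-<-connex (toℕ (row i)) (toℕ b)
    ... | inj₁ ri≤b = cutDegree-below≡ i (below-true ri≤b) (below-true (ℕ.≤-trans rp≤1+ri ri<b))
                                                          (below-true (ℕ.≤-trans rq≤1+ri ri<b))
      where
      ri<b = ℕ.≤∧≢⇒< ri≤b (ri≢b ∘ toℕ-injective)
      rp≤1+ri = proj₂ (adjacent⇒rows≤suc (c (prev i)) (c i) (adjacent-prev i))
      rq≤1+ri = proj₁ (adjacent⇒rows≤suc (c i) (c (next i)) (adjacent i))
    ... | inj₂ b<ri = cutDegree-below≡ i (below-false b<ri) refl refl

    cutDegree-below : ∀ i → cutDegree (rotation len) below i ≡ ⟦ inRow b i ⟧
    cutDegree-below i with row i ≟ b
    ... | yes ri≡b = cutDegree-onRow i ri≡b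
    ... | no ri≢b = cutDegree-offRow i ri≢b

    parity-m≡0ℙ : parity m ≡ 0ℙ
    parity-m≡0ℙ = begin
      parity m                                      ≡⟨ cong parity (rowSize b) ⟨
      parity (∑[ i < suc len ] ⟦ inRow b i ⟧)       ≡⟨ cong parity (sum-cong-≗ cutDegree-below) ⟨
      parity (sum (cutDegree (rotation len) below)) ≡⟨ parity-∑-cutDegree (rotation len) below ⟩
      0ℙ                                            ∎
      where open ≡-Reasoning

  turnsInRow≥2 : parity m ≡ 1ℙ → ∀ b → 2 ≤ turnsInRow b
  turnsInRow≥2 odd b = even∧≢0⇒≥2 (parity-turnsInRow b) λ none →
    ℙ.p≢p⁻¹ 1ℙ (trans (sym odd) (TurnlessRow.parity-m≡0ℙ b (turnless none)))
    where
    turnless : turnsInRow b ≡ 0 → ∀ i → inRow b i ≡ true → isTurn C i ≡ false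
    turnless none i gi = ⟦⟧≡0⇒≡false (subst (λ s → ⟦ s ∧ isTurn C i ⟧ ≡ 0) gi
                                            (sum≡0⇒≡0 (λ j → ⟦ inRow b j ∧ isTurn C j ⟧) none i))

lemma10 : (m n : ℕ) → m % 2 ≡ 1 → (C : HamiltonCycle m n) → 2 * n ≤ turns C
lemma10 m n odd C = begin
  2 * n                    ≡⟨ ℕ.*-comm 2 n ⟩
  n * 2                    ≤⟨ ∑-lowerBound turnsInRow (turnsInRow≥2 (%2≡1⇒parity≡1ℙ m odd)) ⟩
  ∑[ b < n ] turnsInRow b  ≡⟨ turns≡∑turnsInRow ⟨
  turns C                  ∎
  where
  open ℕ.≤-Reasoning
  open HamiltonCycleRows C
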